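{- For every $\gamma,q\in(0,1)$ and every $\alpha\geq1$, it holds that $\mathcal{F}_{q}\nsubseteq(\tilde{\mathcal{F}}_{\gamma}\cup\mathcal{F}_{\alpha})$.
   Context: All functions are set functions $f\colon 2^{U}\to\mathbb{R}_{\geq0}$ on some finite ground set $U$; $f$ is monotone if $X\subseteq Y$ implies $f(X)\leq f(Y)$. Write $[n]=\{1,\dots,n\}$. The greedy algorithm produces $x_1,x_2,\dots$ with $x_i\in\arg\max_{x\in U\setminus\{x_1,\dots,x_{i-1}\}} f(\{x_1,\dots,x_{i-1}\}\cup\{x\})$, and $S^{G}_i=\{x_1,\dots,x_i\}$, $S^{G}_0=\emptyset$; ties are broken by some rule, and each function is considered together with a fixed such greedy run, to which all notions referring to greedy sets refer. $\bar{k}\in[|U|]$ is the smallest index such that $f(S^{G}_{\bar k}\cup\{x\})=f(S^{G}_{\bar k})$ for all $x\in U\setminus S^{G}_{\bar k}$. Weak submodularity ratio: $\gamma(f)=\min_{X\in\{S^{G}_0,\dots,S^{G}_{\bar k}\},\,Y\subseteq U\setminus X}\frac{\sum_{y\in Y}(f(X\cup\{y\})-f(X))}{f(X\cup Y)-f(X)}$ with $\frac00:=1$. $\tilde{\mathcal{F}}_{\gamma}$ is the set of all monotone $f$ with $\gamma(f)\geq\gamma$. For $\alpha\geq1$, $f$ is $\alpha$-augmentable if for all $X\subseteq U$ and $Y\subseteq U$ with $Y\nsubseteq X$ there is $y\in Y\setminus X$ with $f(X\cup\{y\})-f(X)\geq\frac{f(X\cup Y)-\alpha f(X)}{|Y|}$.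 $\mathcal{F}_{\alpha}$ is the set of monotone $\alpha$-augmentable functions. An independence system $(U,\mathcal{I})$ has $\emptyset\in\mathcal{I}\subseteq 2^U$ with $\mathcal{I}$ closed under subsets. For $w\colon U\to\mathbb{R}_{\geq0}$ its weighted rank function is $f(X)=\max\{\sum_{x\in Y}w(x)\mid Y\in\mathcal{I}\cap 2^{X}\}$. The bases $\mathcal{B}(X)$ of $X$ are the inclusion-wise maximal sets of $\mathcal{I}\cap2^X$; the rank quotient is $q(U,\mathcal{I})=\min_{X\subseteq U}\min_{B,B'\in\mathcal{B}(X)}|B|/|B'|$ with $\frac00:=1$. $\mathcal{F}_q$ is the set of weighted rank functions of independence systems with rank quotient at least $q$.
   Formalization: The parameters γ, q and α range over ℚ rather than ℝ, and the weights w and the values of the set functions are taken in ℚ. -}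

module Defs where

open import Data.Bool using (Bool; true; false; if_then_else_; T)
open import Data.Nat as ℕ using (ℕ; zero; suc)
open import Data.Fin using (Fin; toℕ; fromℕ<)
open import Data.Vec using (Vec; []; _∷_; zipWith; tabulate; foldr′)
open import Data.List using (List; []; _∷_; _++_; map; foldr)
open import Data.Fin.Subset using (Subset; ⊥; ⁅_⁆; _∪_; _∈_; _∉_; _⊆_; _⊈_; ∣_∣)
open import Data.Fin.Subset.Properties using (_⊆?_)
open import Data.Integer using (+_)
open import Data.Rational using (ℚ; 0ℚ; 1ℚ; _+_; _-_; _*_; _≤_; _<_; _⊔_; _/_)
open import Data.Product using (Σ; _×_; ∃)
open import Relation.Binary.PropositionalEquality using (_≡_)
open import Relation.Nullary using (¬_; yes; no)

ℕtoℚ : ℕ → ℚ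
ℕtoℚ k = + k / 1

allSubsets : (n : ℕ) → List (Subset n)
allSubsets zero    = [] ∷ []
allSubsets (suc n) = map (false ∷_) (allSubsets n) ++ map (true ∷_) (allSubsets n)

sumOver : {n : ℕ} → Subset n → (Fin n → ℚ) → ℚ
sumOver {n} Y h = foldr′ _+_ 0ℚ (zipWith (λ b v → if b then v else 0ℚ) Y (tabulate h))

SetFn : ℕ → Set
SetFn n = Subset n → ℚ

Monotone : {n : ℕ} → SetFn n → Set
Monotone f = ∀ X Y → X ⊆ Y → f X ≤ f Y

record IndepSystem (n : ℕ) : Set where
  field
    indep     : Subset n → Bool
    empty-ind : T (indep ⊥)
    down-closed : ∀ X Y → X ⊆ Y → T (indep Y) → T (indep X)
open IndepSystem public

-- weighted rank function  f(X) = max { w(Y) | Y ∈ I, Y ⊆ X }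
-- (the maximum over a list that always contains Y = ∅ with value 0)
rankFn : {n : ℕ} → IndepSystem n → (Fin n → ℚ) → SetFn n
rankFn {n} S w X = foldr step 0ℚ (allSubsets n)
  where
  step : Subset n → ℚ → ℚ
  step Y acc with Y ⊆? X
  ... | yes _ = (if indep S Y then sumOver Y w else 0ℚ) ⊔ acc
  ... | no  _ = acc

IsBasis : {n : ℕ} → IndepSystem n → Subset n → Subset n → Set
IsBasis S X B = B ⊆ X × T (indep S B) × (∀ Z → B ⊆ Z → Z ⊆ X → T (indep S Z) → Z ≡ B)

-- rank quotient q(U,I) ≥ q, i.e. |B|/|B'| ≥ q for all X and bases B, B' of X
-- (written multiplicatively; covers the 0/0 := 1 convention, since q ≤ 1 there)
RankQuotientAtLeast : {n : ℕ} → ℚ → IndepSystem n → Set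
RankQuotientAtLeast q S =
  ∀ X B B' → IsBasis S X B → IsBasis S X B' → q * ℕtoℚ ∣ B' ∣ ≤ ℕtoℚ ∣ B ∣

-- S_i = {x_1,…,x_i} where the run is g : Fin n → Fin n (x_{j+1} = g j)
prefix : {n : ℕ} → (Fin n → Fin n) → ℕ → Subset n
prefix g zero = ⊥
prefix {n} g (suc i) with i ℕ.<? n
... | yes i<n = prefix g i ∪ ⁅ g (fromℕ< i<n) ⁆
... | no  _   = prefix g i

IsGreedyRun : {n : ℕ} → SetFn n → (Fin n → Fin n) → Set
IsGreedyRun f g = ∀ j → let X = prefix g (toℕ j) in
  g j ∉ X × (∀ x → x ∉ X → f (X ∪ ⁅ x ⁆) ≤ f (X ∪ ⁅ g j ⁆))

Saturated : {n : ℕ} → SetFn n → Subset n → Set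
Saturated f X = ∀ x → x ∉ X → f (X ∪ ⁅ x ⁆) ≡ f X

IsKbar : {n : ℕ} → SetFn n → (Fin n → Fin n) → ℕ → Set
IsKbar {n} f g k = 1 ℕ.≤ k × k ℕ.≤ n × Saturated f (prefix g k)
  × (∀ i → 1 ℕ.≤ i → i ℕ.< k → ¬ Saturated f (prefix g i))

Disjoint : {n : ℕ} → Subset n → Subset n → Set
Disjoint {n} X Y = ∀ (y : Fin n) → y ∈ Y → y ∉ X

-- γ(f) ≥ γ with respect to the greedy run g
-- (ratio ≥ γ written multiplicatively; for monotone f this is equivalent,
--  including the 0/0 := 1 convention, since γ ≤ 1)
WeakSubmodRatioAtLeast : {n : ℕ} → ℚ → SetFn n → (Fin n → Fin n) → Set
WeakSubmodRatioAtLeast γ f g = ∀ k → IsKbar f g k → ∀ j → j ℕ.≤ k →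
  let X = prefix g j in ∀ Y → Disjoint X Y →
  γ * (f (X ∪ Y) - f X) ≤ sumOver Y (λ y → f (X ∪ ⁅ y ⁆) - f X)

InFtilde : {n : ℕ} → ℚ → SetFn n → (Fin n → Fin n) → Set
InFtilde γ f g = Monotone f × WeakSubmodRatioAtLeast γ f g

-- α-augmentable (inequality multiplied by |Y| > 0)
Augmentable : {n : ℕ} → ℚ → SetFn n → Set
Augmentable {n} α f = ∀ X Y → Y ⊈ X →
  Σ (Fin n) λ y → y ∈ Y × y ∉ X ×
    (f (X ∪ Y) - α * f X ≤ ℕtoℚ ∣ Y ∣ * (f (X ∪ ⁅ y ⁆) - f X))

InFα : {n : ℕ} → ℚ → SetFn n → Set
InFα α f = Monotone f × Augmentable α f

-- membership in F_q: weighted rank function of an independence system with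
-- nonnegative weights and rank quotient ≥ q
NonNegWeights : {n : ℕ} → (Fin n → ℚ) → Set
NonNegWeights w = ∀ i → 0ℚ ≤ w i

{-# OPTIONS --safe #-}
-- The witness is one independence system on the 2M + 2 elements 0, …, 2M+1, where M = L + D:
-- with B = {1, …, M+1} and A = {M+2, …, 2M+1}, a set is independent if it lies in A, or lies
-- in B, or has at most M elements of which at most L are in A; elements of A weigh 1, all
-- others weigh D.  The greedy run 0, 1, 2, … first collects the independent prefix
-- {0, …, M-1} of value DM, after which no single element increases f, so k̄ = M; yet
-- f(B) = D(M+1).  Every marginal gain at S_k̄ therefore vanishes while f(S_k̄ ∪ Y) > f(S_k̄),
-- i.e. γ(f) = 0.  Similarly no element of B increases f(A) = M, since an independent subset
-- of A ∪ {y} weighs at most L + D = M, whereas f(A ∪ B) ≥ D(M+1) > αM once D ≥ α.  Finally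
-- all sets of at most L+1 elements are independent and none of more than M+1 elements is, so
-- the rank quotient is at least (L+1)/(M+1) ≥ q once L is large compared with D.
module Submission where

open import Defs

open import Data.Bool using (true; false; if_then_else_; T)
open import Data.Empty using (⊥-elim)
open import Data.Fin using (Fin; toℕ; fromℕ<) renaming (zero to fzero; suc to fsuc)
import Data.Fin.Properties as FinP
open import Data.Fin.Subset using (Subset; _⊆_; _⊈_; _∈_; _∉_; _∩_; _∪_; ∁; ⁅_⁆; ∣_∣; ⊥; ⊤)
open import Data.Fin.Subset.Properties
open import Data.Integer as ℤ using (+_; -[1+_])
import Data.Integer.Properties as ℤP
open import Data.List using (_∷_; []; map; foldr)
open import Data.List.Membership.Propositional using () renaming (_∈_ to _∈ₗ_)
open import Data.List.Membership.Propositional.Properties using (∈-++⁺ˡ; ∈-++⁺ʳ; ∈-map⁺)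
import Data.List.Relation.Unary.Any as Any
open import Data.Nat as ℕ using (ℕ; zero; suc; z≤n; s≤s; _<?_)
import Data.Nat.Properties as ℕP
open import Data.Nat.Coprimality using (Coprime; 1-coprimeTo)
import Data.Nat.Coprimality as Coprime
open import Data.Nat.Tactic.RingSolver using (solve-∀)
open import Data.Product using (Σ; ∃; _,_; proj₁; proj₂; _×_)
open import Data.Rational as ℚ using (ℚ; mkℚ; 0ℚ; 1ℚ; _≤_; _<_; toℚᵘ; ↥_)
import Data.Rational.Properties as ℚP
open import Data.Rational.Unnormalised as ℚᵘ using (ℚᵘ; mkℚᵘ; *≡*)
import Data.Rational.Unnormalised.Properties as ℚᵘP
open import Data.Sum using (_⊎_; inj₁; inj₂; [_,_]′)
open import Data.Vec using (_∷_; []; lookup; here; there)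
open import Function using (_∘_; id)
open import Relation.Binary.Definitions using (Tri; tri<; tri≈; tri>)
open import Relation.Binary.PropositionalEquality
open import Relation.Nullary using (Dec; yes; no; ¬_; ¬?; contradiction)
open import Relation.Nullary.Decidable using (_⊎-dec_; _×-dec_; isYes; toWitness; fromWitness)

-- Rational arithmetic

p<q⇒0<q-p : ∀ {p q} → p < q → 0ℚ < q ℚ.- p
p<q⇒0<q-p {p} {q} p<q = subst (_< q ℚ.- p) (ℚP.+-inverseʳ p) (ℚP.+-monoˡ-< (ℚ.- p) p<q)

p≤q⇒p-q≤0 : ∀ {p q} → p ≤ q → p ℚ.- q ≤ 0ℚ
p≤q⇒p-q≤0 {p} {q} p≤q = subst (p ℚ.- q ≤_) (ℚP.+-inverseʳ q) (ℚP.+-monoˡ-≤ (ℚ.- q) p≤q)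

ℕtoℚ≡mkℚ : ∀ k → ℕtoℚ k ≡ mkℚ (+ k) 0 (Coprime.sym (1-coprimeTo k))
ℕtoℚ≡mkℚ k = ℚP.normalize-coprime (Coprime.sym (1-coprimeTo k))

toℚᵘ-ℕtoℚ : ∀ k → toℚᵘ (ℕtoℚ k) ≡ mkℚᵘ (+ k) 0
toℚᵘ-ℕtoℚ k rewrite ℕtoℚ≡mkℚ k = refl

ℕtoℚ-+ : ∀ m n → ℕtoℚ (m ℕ.+ n) ≡ ℕtoℚ m ℚ.+ ℕtoℚ n
ℕtoℚ-+ m n = ℚP.toℚᵘ-injective (begin
  toℚᵘ (ℕtoℚ (m ℕ.+ n))             ≡⟨ toℚᵘ-ℕtoℚ (m ℕ.+ n) ⟩
  mkℚᵘ (+ (m ℕ.+ n)) 0              ≈⟨ *≡* (cong (ℤ._* + 1) +[m+n]≡) ⟩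
  mkℚᵘ (+ m) 0 ℚᵘ.+ mkℚᵘ (+ n) 0    ≡⟨ cong₂ ℚᵘ._+_ (toℚᵘ-ℕtoℚ m) (toℚᵘ-ℕtoℚ n) ⟨
  toℚᵘ (ℕtoℚ m) ℚᵘ.+ toℚᵘ (ℕtoℚ n) ≈⟨ ℚP.toℚᵘ-homo-+ (ℕtoℚ m) (ℕtoℚ n) ⟨
  toℚᵘ (ℕtoℚ m ℚ.+ ℕtoℚ n)          ∎)
  where
  open ℚᵘP.≃-Reasoning
  +[m+n]≡ : + (m ℕ.+ n) ≡ + m ℤ.* + 1 ℤ.+ + n ℤ.* + 1
  +[m+n]≡ = trans (ℤP.pos-+ m n) (sym (cong₂ ℤ._+_ (ℤP.*-identityʳ (+ m)) (ℤP.*-identityʳ (+ n))))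

ℕtoℚ-* : ∀ m n → ℕtoℚ (m ℕ.* n) ≡ ℕtoℚ m ℚ.* ℕtoℚ n
ℕtoℚ-* m n = ℚP.toℚᵘ-injective (begin
  toℚᵘ (ℕtoℚ (m ℕ.* n))             ≡⟨ toℚᵘ-ℕtoℚ (m ℕ.* n) ⟩
  mkℚᵘ (+ (m ℕ.* n)) 0              ≈⟨ *≡* (cong (ℤ._* + 1) (ℤP.pos-* m n)) ⟩
  mkℚᵘ (+ m) 0 ℚᵘ.* mkℚᵘ (+ n) 0    ≡⟨ cong₂ ℚᵘ._*_ (toℚᵘ-ℕtoℚ m) (toℚᵘ-ℕtoℚ n) ⟨
  toℚᵘ (ℕtoℚ m) ℚᵘ.* toℚᵘ (ℕtoℚ n) ≈⟨ ℚP.toℚᵘ-homo-* (ℕtoℚ m) (ℕtoℚ n) ⟨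
  toℚᵘ (ℕtoℚ m ℚ.* ℕtoℚ n)          ∎)
  where open ℚᵘP.≃-Reasoning

ℕtoℚ-mono-≤ : ∀ {m n} → m ℕ.≤ n → ℕtoℚ m ≤ ℕtoℚ n
ℕtoℚ-mono-≤ {m} {n} m≤n rewrite ℕtoℚ≡mkℚ m | ℕtoℚ≡mkℚ n =
  ℚ.*≤* (ℤP.*-monoʳ-≤-nonNeg (+ 1) (ℤ.+≤+ m≤n))

ℕtoℚ-mono-< : ∀ {m n} → m ℕ.< n → ℕtoℚ m < ℕtoℚ n
ℕtoℚ-mono-< {m} {n} m<n rewrite ℕtoℚ≡mkℚ m | ℕtoℚ≡mkℚ n =
  ℚ.*<* (ℤP.*-monoʳ-<-pos (+ 1) (ℤ.+<+ m<n))

0≤ℕtoℚ : ∀ k → 0ℚ ≤ ℕtoℚ k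
0≤ℕtoℚ k = ℕtoℚ-mono-≤ {0} {k} z≤n

p≤ℕtoℚ[1+∣↥p∣] : ∀ p → p ≤ ℕtoℚ (suc ℤ.∣ ↥ p ∣)
p≤ℕtoℚ[1+∣↥p∣] (mkℚ (+ a) d _) rewrite ℕtoℚ≡mkℚ (suc a) =
  ℚ.*≤* (subst₂ ℤ._≤_ (ℤP.pos-* a 1) (ℤP.pos-* (suc a) (suc d))
    (ℤ.+≤+ (ℕP.≤-trans (ℕP.≤-reflexive (ℕP.*-identityʳ a)) (ℕP.m≤n⇒m≤n*o (suc d) (ℕP.n≤1+n a)))))
p≤ℕtoℚ[1+∣↥p∣] (mkℚ -[1+ a ] d _) rewrite ℕtoℚ≡mkℚ (suc (suc a)) = ℚ.*≤* ℤ.-≤+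

mkℚ*ℕtoℚ≤ℕtoℚ : ∀ p r .(c : Coprime p (suc r)) K J → p ℕ.* K ℕ.≤ suc r ℕ.* J →
                mkℚ (+ p) r c ℚ.* ℕtoℚ K ≤ ℕtoℚ J
mkℚ*ℕtoℚ≤ℕtoℚ p r c K J pK≤[1+r]J = ℚP.toℚᵘ-cancel-≤ (begin
  toℚᵘ (mkℚ (+ p) r c ℚ.* ℕtoℚ K)  ≃⟨ ℚP.toℚᵘ-homo-* (mkℚ (+ p) r c) (ℕtoℚ K) ⟩
  mkℚᵘ (+ p) r ℚᵘ.* toℚᵘ (ℕtoℚ K)  ≡⟨ cong (mkℚᵘ (+ p) r ℚᵘ.*_) (toℚᵘ-ℕtoℚ K) ⟩
  mkℚᵘ (+ p) r ℚᵘ.* mkℚᵘ (+ K) 0   ≤⟨ ℚᵘ.*≤* (subst₂ ℤ._≤_ lhs rhs (ℤ.+≤+ pK≤[1+r]J)) ⟩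
  mkℚᵘ (+ J) 0                     ≡⟨ toℚᵘ-ℕtoℚ J ⟨
  toℚᵘ (ℕtoℚ J)                    ∎)
  where
  open ℚᵘP.≤-Reasoning
  lhs : + (p ℕ.* K) ≡ (+ p ℤ.* + K) ℤ.* + 1
  lhs = trans (ℤP.pos-* p K) (sym (ℤP.*-identityʳ _))
  rhs : + (suc r ℕ.* J) ≡ + J ℤ.* + suc (r ℕ.* 1)
  rhs = trans (cong +_ (trans (ℕP.*-comm (suc r) J) (cong (λ s → J ℕ.* suc s) (sym (ℕP.*-identityʳ r)))))
              (ℤP.pos-* J _)

∃[L]q*[1+L+D]≤1+L : ∀ q D → 0ℚ ≤ q → q < 1ℚ →
                    ∃ λ L → q ℚ.* ℕtoℚ (suc (L ℕ.+ D)) ≤ ℕtoℚ (suc L)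
∃[L]q*[1+L+D]≤1+L (mkℚ -[1+ _ ] _ _) D (ℚ.*≤* ()) _
∃[L]q*[1+L+D]≤1+L (mkℚ (+ p) r c) D _ (ℚ.*<* q<1) =
  r ℕ.* D , mkℚ*ℕtoℚ≤ℕtoℚ p r c _ _ (begin
    p ℕ.* suc (r ℕ.* D ℕ.+ D)             ≤⟨ ℕP.*-monoˡ-≤ _ p≤r ⟩
    r ℕ.* suc (r ℕ.* D ℕ.+ D)             ≡⟨ distrib r D ⟩
    r ℕ.* suc (r ℕ.* D) ℕ.+ r ℕ.* D       ≤⟨ ℕP.+-monoʳ-≤ (r ℕ.* suc (r ℕ.* D)) (ℕP.n≤1+n (r ℕ.* D)) ⟩
    r ℕ.* suc (r ℕ.* D) ℕ.+ suc (r ℕ.* D) ≡⟨ ℕP.+-comm _ (suc (r ℕ.* D)) ⟩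
    suc r ℕ.* suc (r ℕ.* D)               ∎)
  where
  open ℕP.≤-Reasoning
  p≤r : p ℕ.≤ r
  p≤r = ℕ.s≤s⁻¹ (ℤP.drop‿+<+ (subst₂ ℤ._<_ (ℤP.*-identityʳ (+ p)) (ℤP.*-identityˡ (+ suc r)) q<1))
  distrib : ∀ a b → a ℕ.* suc (a ℕ.* b ℕ.+ b) ≡ a ℕ.* suc (a ℕ.* b) ℕ.+ a ℕ.* b
  distrib = solve-∀

-- Weighted rank functions

allSubsets-complete : ∀ {n} (Y : Subset n) → Y ∈ₗ allSubsets n
allSubsets-complete []          = Any.here refl
allSubsets-complete {suc n} (false ∷ Y) = ∈-++⁺ˡ (∈-map⁺ (false ∷_) (allSubsets-complete Y))
allSubsets-complete {suc n} (true ∷ Y)  =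
  ∈-++⁺ʳ (map (false ∷_) (allSubsets n)) (∈-map⁺ (true ∷_) (allSubsets-complete Y))

-- The step function folded by rankFn is local to its where block; this gives it a name.
rankFn-foldr : ∀ {n} (S : IndepSystem n) w X →
               Σ (Subset n → ℚ → ℚ) λ step → rankFn S w X ≡ foldr step 0ℚ (allSubsets n)
rankFn-foldr S w X = _ , refl

module _ {n} (S : IndepSystem n) (w : Fin n → ℚ) (X : Subset n) where

  private
    step : Subset n → ℚ → ℚ
    step = proj₁ (rankFn-foldr S w X)

    step-lub : ∀ {v} → 0ℚ ≤ v → (∀ I → I ⊆ X → T (indep S I) → sumOver I w ≤ v) →
               ∀ Y {acc} → acc ≤ v → step Y acc ≤ v
    step-lub 0≤v bound Y acc≤v with Y ⊆? X
    ... | no _    = acc≤v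
    ... | yes Y⊆X with indep S Y in eq
    ...   | true  = ℚP.⊔-lub (bound Y Y⊆X (subst T (sym eq) _)) acc≤v
    ...   | false = ℚP.⊔-lub 0≤v acc≤v

    acc≤step : ∀ Y acc → acc ≤ step Y acc
    acc≤step Y acc with Y ⊆? X
    ... | no _  = ℚP.≤-refl
    ... | yes _ = ℚP.p≤q⊔p (if indep S Y then sumOver Y w else 0ℚ) acc

    indep⇒sumOver≤step : ∀ {I} acc → I ⊆ X → T (indep S I) → sumOver I w ≤ step I acc
    indep⇒sumOver≤step {I} acc I⊆X indepI with I ⊆? X
    ... | no I⊈X = ⊥-elim (I⊈X I⊆X)
    ... | yes _ with indep S I
    ...   | true = ℚP.p≤p⊔q _ acc

    foldr-lub : ∀ {v} → 0ℚ ≤ v → (∀ I → I ⊆ X → T (indep S I) → sumOver I w ≤ v) →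
                ∀ Ys → foldr step 0ℚ Ys ≤ v
    foldr-lub 0≤v bound []       = 0≤v
    foldr-lub 0≤v bound (Y ∷ Ys) = step-lub 0≤v bound Y (foldr-lub 0≤v bound Ys)

    indep⇒sumOver≤foldr : ∀ {I} → I ⊆ X → T (indep S I) → ∀ {Ys} → I ∈ₗ Ys → sumOver I w ≤ foldr step 0ℚ Ys
    indep⇒sumOver≤foldr I⊆X indepI (Any.here refl) = indep⇒sumOver≤step _ I⊆X indepI
    indep⇒sumOver≤foldr I⊆X indepI {Y ∷ _} (Any.there I∈Ys) =
      ℚP.≤-trans (indep⇒sumOver≤foldr I⊆X indepI I∈Ys) (acc≤step Y _)

  rankFn-lub : ∀ {v} → 0ℚ ≤ v → (∀ I → I ⊆ X → T (indep S I) → sumOver I w ≤ v) → rankFn S w X ≤ v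
  rankFn-lub 0≤v bound = foldr-lub 0≤v bound (allSubsets n)

  indep⇒sumOver≤rankFn : ∀ {I} → I ⊆ X → T (indep S I) → sumOver I w ≤ rankFn S w X
  indep⇒sumOver≤rankFn {I} I⊆X indepI = indep⇒sumOver≤foldr I⊆X indepI (allSubsets-complete I)

-- Subsets of Fin n

∣p∣≡∣p∩q∣+∣p∩∁q∣ : ∀ {n} (p q : Subset n) → ∣ p ∣ ≡ ∣ p ∩ q ∣ ℕ.+ ∣ p ∩ ∁ q ∣
∣p∣≡∣p∩q∣+∣p∩∁q∣ []          []          = refl
∣p∣≡∣p∩q∣+∣p∩∁q∣ (true ∷ p)  (true ∷ q)  = cong suc (∣p∣≡∣p∩q∣+∣p∩∁q∣ p q)
∣p∣≡∣p∩q∣+∣p∩∁q∣ (true ∷ p)  (false ∷ q) =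
  trans (cong suc (∣p∣≡∣p∩q∣+∣p∩∁q∣ p q)) (sym (ℕP.+-suc _ _))
∣p∣≡∣p∩q∣+∣p∩∁q∣ (false ∷ p) (_ ∷ q)     = ∣p∣≡∣p∩q∣+∣p∩∁q∣ p q

x∉p⇒∣p∪⁅x⁆∣≡1+∣p∣ : ∀ {n} {p : Subset n} {x} → x ∉ p → ∣ p ∪ ⁅ x ⁆ ∣ ≡ suc ∣ p ∣
x∉p⇒∣p∪⁅x⁆∣≡1+∣p∣ {p = true ∷ p}  {fzero}  x∉p = contradiction here x∉p
x∉p⇒∣p∪⁅x⁆∣≡1+∣p∣ {p = false ∷ p} {fzero}  x∉p = cong (suc ∘ ∣_∣) (∪-identityʳ p)
x∉p⇒∣p∪⁅x⁆∣≡1+∣p∣ {p = true ∷ p}  {fsuc x} x∉p = cong suc (x∉p⇒∣p∪⁅x⁆∣≡1+∣p∣ (x∉p ∘ there))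
x∉p⇒∣p∪⁅x⁆∣≡1+∣p∣ {p = false ∷ p} {fsuc x} x∉p = x∉p⇒∣p∪⁅x⁆∣≡1+∣p∣ (x∉p ∘ there)

p⊆r⇒x∈r⇒p∪⁅x⁆⊆r : ∀ {n} {p r : Subset n} {x} → p ⊆ r → x ∈ r → p ∪ ⁅ x ⁆ ⊆ r
p⊆r⇒x∈r⇒p∪⁅x⁆⊆r {p = p} {r} {x} p⊆r x∈r =
  [ p⊆r , (λ y∈⁅x⁆ → subst (_∈ r) (sym (x∈⁅y⁆⇒x≡y x y∈⁅x⁆)) x∈r) ]′ ∘ x∈p∪q⁻ p ⁅ x ⁆

∣p∪⁅x⁆∣≤1+∣p∣ : ∀ {n} (p : Subset n) x → ∣ p ∪ ⁅ x ⁆ ∣ ℕ.≤ suc ∣ p ∣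
∣p∪⁅x⁆∣≤1+∣p∣ p x with x ∈? p
... | no x∉p = ℕP.≤-reflexive (x∉p⇒∣p∪⁅x⁆∣≡1+∣p∣ x∉p)
... | yes x∈p = ℕP.m≤n⇒m≤1+n (p⊆q⇒∣p∣≤∣q∣ (p⊆r⇒x∈r⇒p∪⁅x⁆⊆r id x∈p))

disjoint⇒∣p∩q∣≡0 : ∀ {n} {p q : Subset n} → (∀ {x} → x ∈ p → x ∉ q) → ∣ p ∩ q ∣ ≡ 0
disjoint⇒∣p∩q∣≡0 {n} {p} {q} disjoint = trans (cong ∣_∣ (Empty-unique empty)) (∣⊥∣≡0 n)
  where
  empty : ¬ ∃ λ x → x ∈ p ∩ q
  empty (x , x∈p∩q) = let x∈p , x∈q = x∈p∩q⁻ p q x∈p∩q in disjoint x∈p x∈q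

∣p∣≤∣p∩q∣⇒p⊆q : ∀ {n} {p q : Subset n} → ∣ p ∣ ℕ.≤ ∣ p ∩ q ∣ → p ⊆ q
∣p∣≤∣p∩q∣⇒p⊆q {p = p} {q} ∣p∣≤ {x} x∈p with x ∈? q
... | yes x∈q = x∈q
... | no x∉q  = contradiction ∣p∣≤ (ℕP.<⇒≱ (p⊂q⇒∣p∣<∣q∣ (p∩q⊆p p q , x , x∈p , x∉q ∘ proj₂ ∘ x∈p∩q⁻ p q)))

p⊆q⇒∣p∩r∣≤∣q∩r∣ : ∀ {n} {p q : Subset n} r → p ⊆ q → ∣ p ∩ r ∣ ℕ.≤ ∣ q ∩ r ∣
p⊆q⇒∣p∩r∣≤∣q∩r∣ {p = p} r p⊆q = p⊆q⇒∣p∣≤∣q∣ λ x∈ → let (x∈p , x∈r) = x∈p∩q⁻ p r x∈ in x∈p∩q⁺ (p⊆q x∈p , x∈r)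

p⊆q⇒∣q∩∁p∣≡∣q∣∸∣p∣ : ∀ {n} {p q : Subset n} → p ⊆ q → ∣ q ∩ ∁ p ∣ ≡ ∣ q ∣ ℕ.∸ ∣ p ∣
p⊆q⇒∣q∩∁p∣≡∣q∣∸∣p∣ {p = p} {q} p⊆q = begin
  ∣ q ∩ ∁ p ∣                         ≡⟨ ℕP.m+n∸m≡n ∣ p ∣ _ ⟨
  ∣ p ∣ ℕ.+ ∣ q ∩ ∁ p ∣ ℕ.∸ ∣ p ∣       ≡⟨ cong (λ k → k ℕ.+ ∣ q ∩ ∁ p ∣ ℕ.∸ ∣ p ∣) ∣p∣≡∣q∩p∣ ⟩
  ∣ q ∩ p ∣ ℕ.+ ∣ q ∩ ∁ p ∣ ℕ.∸ ∣ p ∣   ≡⟨ cong (ℕ._∸ ∣ p ∣) (∣p∣≡∣p∩q∣+∣p∩∁q∣ q p) ⟨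
  ∣ q ∣ ℕ.∸ ∣ p ∣                     ∎
  where
  open ≡-Reasoning
  ∣p∣≡∣q∩p∣ : ∣ p ∣ ≡ ∣ q ∩ p ∣
  ∣p∣≡∣q∩p∣ = ℕP.≤-antisym (p⊆q⇒∣p∣≤∣q∣ λ x∈p → x∈p∩q⁺ (p⊆q x∈p , x∈p)) (∣p∩q∣≤∣q∣ q p)

∣p∣<∣q∣⇒∃[x∈q∖p] : ∀ {n} {p q : Subset n} → ∣ p ∣ ℕ.< ∣ q ∣ → ∃ λ x → x ∈ q × x ∉ p
∣p∣<∣q∣⇒∃[x∈q∖p] {p = p} {q} ∣p∣<∣q∣ with FinP.any? (λ x → x ∈? q ×-dec ¬? (x ∈? p))
... | yes witness = witness
... | no ∄ = contradiction (p⊆q⇒∣p∣≤∣q∣ q⊆p) (ℕP.<⇒≱ ∣p∣<∣q∣)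
  where
  q⊆p : q ⊆ p
  q⊆p {x} x∈q with x ∈? p
  ... | yes x∈p = x∈p
  ... | no x∉p  = contradiction (x , x∈q , x∉p) ∄

sumOver-zero : ∀ {n} (Y : Subset n) {h : Fin n → ℚ} → (∀ {x} → x ∈ Y → h x ≡ 0ℚ) → sumOver Y h ≡ 0ℚ
sumOver-zero []          h≡0 = refl
sumOver-zero (true ∷ Y)  h≡0 = cong₂ ℚ._+_ (h≡0 here) (sumOver-zero Y (h≡0 ∘ there))
sumOver-zero (false ∷ Y) h≡0 = trans (ℚP.+-identityˡ _) (sumOver-zero Y (h≡0 ∘ there))

sumOver-twoValued : ∀ {n} D (Y P : Subset n) →
  sumOver Y (λ x → ℕtoℚ (if lookup P x then 1 else D)) ≡ ℕtoℚ (∣ Y ∩ P ∣ ℕ.+ D ℕ.* ∣ Y ∩ ∁ P ∣)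
sumOver-twoValued D []          []          = cong ℕtoℚ (sym (ℕP.*-zeroʳ D))
sumOver-twoValued D (false ∷ Y) (_ ∷ P)     = trans (ℚP.+-identityˡ _) (sumOver-twoValued D Y P)
sumOver-twoValued D (true ∷ Y)  (true ∷ P)  =
  trans (cong (ℕtoℚ 1 ℚ.+_) (sumOver-twoValued D Y P)) (sym (ℕtoℚ-+ 1 (∣ Y ∩ P ∣ ℕ.+ D ℕ.* ∣ Y ∩ ∁ P ∣)))
sumOver-twoValued D (true ∷ Y)  (false ∷ P) =
  trans (cong (ℕtoℚ D ℚ.+_) (sumOver-twoValued D Y P))
        (trans (sym (ℕtoℚ-+ D (∣ Y ∩ P ∣ ℕ.+ D ℕ.* ∣ Y ∩ ∁ P ∣)))
               (cong ℕtoℚ (shuffle D ∣ Y ∩ P ∣ ∣ Y ∩ ∁ P ∣)))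
  where
  shuffle : ∀ b a e → b ℕ.+ (a ℕ.+ b ℕ.* e) ≡ a ℕ.+ b ℕ.* suc e
  shuffle = solve-∀

-- Prefixes of greedy runs

module _ {n} (g : Fin n → Fin n) where

  prefix-suc : ∀ {i} (i<n : i ℕ.< n) → prefix g (suc i) ≡ prefix g i ∪ ⁅ g (fromℕ< i<n) ⁆
  prefix-suc {i} i<n with i <? n
  ... | yes _   = refl
  ... | no i≮n = contradiction i<n i≮n

  prefix-suc-toℕ : ∀ j → prefix g (suc (toℕ j)) ≡ prefix g (toℕ j) ∪ ⁅ g j ⁆
  prefix-suc-toℕ j = trans (prefix-suc (FinP.toℕ<n j))
                           (cong (λ x → prefix g (toℕ j) ∪ ⁅ g x ⁆) (FinP.fromℕ<-toℕ j _))

  prefix-⊆-suc : ∀ i → prefix g i ⊆ prefix g (suc i)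
  prefix-⊆-suc i with i <? n
  ... | yes _ = p⊆p∪q _
  ... | no _  = id

  prefix-mono : ∀ {i j} → i ℕ.≤ j → prefix g i ⊆ prefix g j
  prefix-mono {j = zero} z≤n = id
  prefix-mono {i} {suc j} i≤1+j with ℕP.m≤n⇒m<n∨m≡n i≤1+j
  ... | inj₁ i<1+j = prefix-⊆-suc j ∘ prefix-mono (ℕ.s≤s⁻¹ i<1+j)
  ... | inj₂ refl  = id

∈prefix-id⇒toℕ< : ∀ {n} i {x : Fin n} → x ∈ prefix id i → toℕ x ℕ.< i
∈prefix-id⇒toℕ< zero x∈ = contradiction x∈ ∉⊥
∈prefix-id⇒toℕ< {n} (suc i) {x} x∈ with i <? n
... | no _ = ℕP.m<n⇒m<1+n (∈prefix-id⇒toℕ< i x∈)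
... | yes i<n with x∈p∪q⁻ (prefix id i) _ x∈
...   | inj₁ x∈prefix = ℕP.m<n⇒m<1+n (∈prefix-id⇒toℕ< i x∈prefix)
...   | inj₂ x∈⁅i⁆    = ℕP.≤-reflexive (cong suc (trans (cong toℕ (x∈⁅y⁆⇒x≡y _ x∈⁅i⁆)) (FinP.toℕ-fromℕ< i<n)))

toℕ<⇒∈prefix-id : ∀ {n} {i} {x : Fin n} → toℕ x ℕ.< i → x ∈ prefix id i
toℕ<⇒∈prefix-id {x = x} x<i =
  prefix-mono id x<i (subst (x ∈_) (sym (prefix-suc-toℕ id x)) (q⊆p∪q _ _ (x∈⁅x⁆ x)))

∣prefix-id∣ : ∀ {n} i → i ℕ.≤ n → ∣ prefix {n} id i ∣ ≡ i
∣prefix-id∣ {n} zero _ = ∣⊥∣≡0 n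
∣prefix-id∣ (suc i) i<n rewrite prefix-suc id i<n =
  trans (x∉p⇒∣p∪⁅x⁆∣≡1+∣p∣ new) (cong suc (∣prefix-id∣ i (ℕP.<⇒≤ i<n)))
  where
  new : fromℕ< i<n ∉ prefix id i
  new x∈ = ℕP.<-irrefl (FinP.toℕ-fromℕ< i<n) (∈prefix-id⇒toℕ< i x∈)

-- Criteria for the rank quotient, the weak submodularity ratio and augmentability

module _ {n} (S : IndepSystem n) where

  basis-size : ∀ {l X Bs} → (∀ I → ∣ I ∣ ℕ.≤ l → T (indep S I)) → IsBasis S X Bs →
               ∣ X ∣ ℕ.≤ ∣ Bs ∣ ⊎ l ℕ.≤ ∣ Bs ∣
  basis-size {l} {X} {Bs} small⇒indep (Bs⊆X , _ , maximal) with ∣ X ∣ ℕ.≤? ∣ Bs ∣ | l ℕ.≤? ∣ Bs ∣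
  ... | yes X≤Bs | _        = inj₁ X≤Bs
  ... | no _     | yes l≤Bs = inj₂ l≤Bs
  ... | no X≰Bs  | no l≰Bs  with ∣p∣<∣q∣⇒∃[x∈q∖p] (ℕP.≰⇒> X≰Bs)
  ...   | z , z∈X , z∉Bs = contradiction (subst (z ∈_) Bs∪z≡Bs (q⊆p∪q Bs ⁅ z ⁆ (x∈⁅x⁆ z))) z∉Bs
    where
    Bs∪z≡Bs : Bs ∪ ⁅ z ⁆ ≡ Bs
    Bs∪z≡Bs = maximal _ (p⊆p∪q ⁅ z ⁆) (p⊆r⇒x∈r⇒p∪⁅x⁆⊆r Bs⊆X z∈X)
                (small⇒indep _ (ℕP.≤-trans (∣p∪⁅x⁆∣≤1+∣p∣ Bs z) (ℕP.≰⇒> l≰Bs)))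

  sizeBounds⇒RankQuotientAtLeast : ∀ {q m l} → 0ℚ ≤ q → q ≤ 1ℚ →
    (∀ I → T (indep S I) → ∣ I ∣ ℕ.≤ m) → (∀ I → ∣ I ∣ ℕ.≤ l → T (indep S I)) →
    q ℚ.* ℕtoℚ m ≤ ℕtoℚ l → RankQuotientAtLeast q S
  sizeBounds⇒RankQuotientAtLeast {q} {m} {l} 0≤q q≤1 indep⇒small small⇒indep qm≤l X Bs Bs′ basis basis′ =
    [ via-∣X∣ , via-l ]′ (basis-size small⇒indep basis)
    where
    open ℚP.≤-Reasoning
    via-∣X∣ : ∣ X ∣ ℕ.≤ ∣ Bs ∣ → q ℚ.* ℕtoℚ ∣ Bs′ ∣ ≤ ℕtoℚ ∣ Bs ∣
    via-∣X∣ X≤Bs = begin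
      q ℚ.* ℕtoℚ ∣ Bs′ ∣   ≤⟨ ℚP.*-monoʳ-≤-nonNeg (ℕtoℚ ∣ Bs′ ∣) {{ℚ.nonNegative (0≤ℕtoℚ ∣ Bs′ ∣)}} q≤1 ⟩
      1ℚ ℚ.* ℕtoℚ ∣ Bs′ ∣  ≡⟨ ℚP.*-identityˡ _ ⟩
      ℕtoℚ ∣ Bs′ ∣         ≤⟨ ℕtoℚ-mono-≤ (ℕP.≤-trans (p⊆q⇒∣p∣≤∣q∣ (proj₁ basis′)) X≤Bs) ⟩
      ℕtoℚ ∣ Bs ∣          ∎
    via-l : l ℕ.≤ ∣ Bs ∣ → q ℚ.* ℕtoℚ ∣ Bs′ ∣ ≤ ℕtoℚ ∣ Bs ∣
    via-l l≤Bs = begin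
      q ℚ.* ℕtoℚ ∣ Bs′ ∣   ≤⟨ ℚP.*-monoˡ-≤-nonNeg q {{ℚ.nonNegative 0≤q}}
                               (ℕtoℚ-mono-≤ (indep⇒small Bs′ (proj₁ (proj₂ basis′)))) ⟩
      q ℚ.* ℕtoℚ m         ≤⟨ qm≤l ⟩
      ℕtoℚ l               ≤⟨ ℕtoℚ-mono-≤ l≤Bs ⟩
      ℕtoℚ ∣ Bs ∣          ∎

stalled⇒¬WeakSubmodRatioAtLeast : ∀ {n γ} {f : SetFn n} {g k} → 0ℚ < γ → IsKbar f g k →
                                  f (prefix g k) < f ⊤ → ¬ WeakSubmodRatioAtLeast γ f g
stalled⇒¬WeakSubmodRatioAtLeast {γ = γ} {f} {g} {k} 0<γ kbar@(_ , _ , saturated , _) stalled wsr =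
  ℚP.<-irrefl refl (begin-strict
    0ℚ                                          <⟨ 0<γ*gap ⟩
    γ ℚ.* (f (X ∪ ∁ X) ℚ.- f X)                 ≤⟨ wsr k kbar k ℕP.≤-refl (∁ X) (λ _ → x∈∁p⇒x∉p) ⟩
    sumOver (∁ X) (λ y → f (X ∪ ⁅ y ⁆) ℚ.- f X) ≡⟨ sumOver-zero (∁ X) no-gain ⟩
    0ℚ                                          ∎)
  where
  open ℚP.≤-Reasoning
  X : Subset _
  X = prefix g k
  no-gain : ∀ {y} → y ∈ ∁ X → f (X ∪ ⁅ y ⁆) ℚ.- f X ≡ 0ℚ
  no-gain y∈∁X = trans (cong (ℚ._- f X) (saturated _ (x∈∁p⇒x∉p y∈∁X))) (ℚP.+-inverseʳ (f X))
  0<gap : 0ℚ < f (X ∪ ∁ X) ℚ.- f X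
  0<gap = p<q⇒0<q-p (subst (λ Y → f X < f Y) (sym (p∪∁p≡⊤ X)) stalled)
  0<γ*gap : 0ℚ < γ ℚ.* (f (X ∪ ∁ X) ℚ.- f X)
  0<γ*gap = ℚP.positive⁻¹ _ {{ℚP.pos*pos⇒pos γ {{ℚ.positive 0<γ}} _ {{ℚ.positive 0<gap}}}}

gainless⇒¬Augmentable : ∀ {n α} {f : SetFn n} {X Y} → Y ⊈ X → (∀ {y} → y ∈ Y → f (X ∪ ⁅ y ⁆) ≤ f X) →
                        α ℚ.* f X < f (X ∪ Y) → ¬ Augmentable α f
gainless⇒¬Augmentable {α = α} {f} {X} {Y} Y⊈X gainless αfX<f[X∪Y] aug =
  let y , y∈Y , _ , augment = aug X Y Y⊈X in ℚP.<-irrefl refl (begin-strict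
  0ℚ                                         <⟨ p<q⇒0<q-p αfX<f[X∪Y] ⟩
  f (X ∪ Y) ℚ.- α ℚ.* f X                    ≤⟨ augment ⟩
  ℕtoℚ ∣ Y ∣ ℚ.* (f (X ∪ ⁅ y ⁆) ℚ.- f X)      ≤⟨ ℚP.*-monoˡ-≤-nonNeg (ℕtoℚ ∣ Y ∣)
                                                  {{ℚ.nonNegative (0≤ℕtoℚ ∣ Y ∣)}} (p≤q⇒p-q≤0 (gainless y∈Y)) ⟩
  ℕtoℚ ∣ Y ∣ ℚ.* 0ℚ                          ≡⟨ ℚP.*-zeroʳ (ℕtoℚ ∣ Y ∣) ⟩
  0ℚ                                         ∎)
  where open ℚP.≤-Reasoning

module Counterexample (L d : ℕ) where

  D M n : ℕ
  D = suc d
  M = L ℕ.+ D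
  n = 2 ℕ.+ M ℕ.+ M

  P : ℕ → Subset n
  P = prefix id

  -- P i = {0, …, i-1}, so A = {M+2, …, 2M+1} and B = {1, …, M+1}.
  A B : Subset n
  A = ∁ (P (2 ℕ.+ M))
  B = P (2 ℕ.+ M) ∩ ∁ (P 1)

  Independent : Subset n → Set
  Independent I = I ⊆ A ⊎ I ⊆ B ⊎ (∣ I ∩ A ∣ ℕ.≤ L × ∣ I ∣ ℕ.≤ M)

  independent? : ∀ I → Dec (Independent I)
  independent? I = I ⊆? A ⊎-dec I ⊆? B ⊎-dec (∣ I ∩ A ∣ ℕ.≤? L ×-dec ∣ I ∣ ℕ.≤? M)

  Independent-⊆ : ∀ {I J} → I ⊆ J → Independent J → Independent I
  Independent-⊆ I⊆J (inj₁ J⊆A)               = inj₁ (J⊆A ∘ I⊆J)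
  Independent-⊆ I⊆J (inj₂ (inj₁ J⊆B))        = inj₂ (inj₁ (J⊆B ∘ I⊆J))
  Independent-⊆ I⊆J (inj₂ (inj₂ (∣J∩A∣≤L , ∣J∣≤M))) =
    inj₂ (inj₂ (ℕP.≤-trans (p⊆q⇒∣p∩r∣≤∣q∩r∣ A I⊆J) ∣J∩A∣≤L , ℕP.≤-trans (p⊆q⇒∣p∣≤∣q∣ I⊆J) ∣J∣≤M))

  system : IndepSystem n
  system = record
    { indep       = isYes ∘ independent?
    ; empty-ind   = fromWitness {a? = independent? _} (inj₁ (⊆-min A))
    ; down-closed = λ I J I⊆J → fromWitness {a? = independent? I} ∘ Independent-⊆ I⊆J ∘ toWitness
    }

  indep⇒Independent : ∀ {I} → T (indep system I) → Independent I
  indep⇒Independent {I} = toWitness {a? = independent? I}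

  Independent⇒indep : ∀ {I} → Independent I → T (indep system I)
  Independent⇒indep {I} = fromWitness {a? = independent? I}

  w : Fin n → ℚ
  w x = ℕtoℚ (if lookup A x then 1 else D)

  f : SetFn n
  f = rankFn system w

  weight : Subset n → ℕ
  weight I = ∣ I ∩ A ∣ ℕ.+ D ℕ.* ∣ I ∩ ∁ A ∣

  1+L≤M : suc L ℕ.≤ M
  1+L≤M = ℕP.≤-trans (s≤s (ℕP.m≤m+n L d)) (ℕP.≤-reflexive (sym (ℕP.+-suc L d)))

  1≤M : 1 ℕ.≤ M
  1≤M = ℕP.≤-trans (s≤s z≤n) (ℕP.m≤n+m D L)

  M≤n : M ℕ.≤ n
  M≤n = ℕP.m≤n+m M (2 ℕ.+ M)

  ∣P∣ : ∀ {i} → i ℕ.≤ n → ∣ P i ∣ ≡ i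
  ∣P∣ = ∣prefix-id∣ _

  ∣A∣ : ∣ A ∣ ≡ M
  ∣A∣ = begin
    ∣ A ∣                       ≡⟨ ∣∁p∣≡n∸∣p∣ (P (2 ℕ.+ M)) ⟩
    n ℕ.∸ ∣ P (2 ℕ.+ M) ∣       ≡⟨ cong (n ℕ.∸_) (∣P∣ (ℕP.m≤m+n (2 ℕ.+ M) M)) ⟩
    2 ℕ.+ M ℕ.+ M ℕ.∸ (2 ℕ.+ M) ≡⟨ ℕP.m+n∸m≡n (2 ℕ.+ M) M ⟩
    M                           ∎
    where open ≡-Reasoning

  ∣B∣ : ∣ B ∣ ≡ suc M
  ∣B∣ = trans (p⊆q⇒∣q∩∁p∣≡∣q∣∸∣p∣ {p = P 1} {q = P (2 ℕ.+ M)} (prefix-mono id {1} {2 ℕ.+ M} (s≤s z≤n)))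
              (cong₂ ℕ._∸_ (∣P∣ (ℕP.m≤m+n (2 ℕ.+ M) M)) (∣P∣ (s≤s z≤n)))

  P-disjoint-A : ∀ {i x} → i ℕ.≤ 2 ℕ.+ M → x ∈ P i → x ∉ A
  P-disjoint-A i≤2+M = x∈p⇒x∉∁p ∘ prefix-mono id i≤2+M

  B-disjoint-A : ∀ {x} → x ∈ B → x ∉ A
  B-disjoint-A = P-disjoint-A ℕP.≤-refl ∘ proj₁ ∘ x∈p∩q⁻ (P (2 ℕ.+ M)) (∁ (P 1))

  zero∉B : fzero ∉ B
  zero∉B = x∈p⇒x∉∁p (toℕ<⇒∈prefix-id {i = 1} (s≤s z≤n)) ∘ proj₂ ∘ x∈p∩q⁻ (P (2 ℕ.+ M)) (∁ (P 1))

  B⊈A : B ⊈ A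
  B⊈A B⊆A = ℕP.<-irrefl refl (begin-strict
    0          <⟨ s≤s z≤n ⟩
    suc M      ≡⟨ ∣B∣ ⟨
    ∣ B ∣      ≤⟨ p⊆q⇒∣p∣≤∣q∣ (λ x∈B → x∈p∩q⁺ (x∈B , B⊆A x∈B)) ⟩
    ∣ B ∩ A ∣  ≡⟨ disjoint⇒∣p∩q∣≡0 B-disjoint-A ⟩
    0          ∎)
    where open ℕP.≤-Reasoning

  Independent⇒∣∣≤1+M : ∀ {I} → Independent I → ∣ I ∣ ℕ.≤ suc M
  Independent⇒∣∣≤1+M {I} (inj₁ I⊆A)        = ℕP.m≤n⇒m≤1+n (subst (∣ I ∣ ℕ.≤_) ∣A∣ (p⊆q⇒∣p∣≤∣q∣ I⊆A))
  Independent⇒∣∣≤1+M {I} (inj₂ (inj₁ I⊆B)) = subst (∣ I ∣ ℕ.≤_) ∣B∣ (p⊆q⇒∣p∣≤∣q∣ I⊆B)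
  Independent⇒∣∣≤1+M (inj₂ (inj₂ (_ , ∣I∣≤M))) = ℕP.m≤n⇒m≤1+n ∣I∣≤M

  ∣∣≤1+L⇒Independent : ∀ {I} → ∣ I ∣ ℕ.≤ suc L → Independent I
  ∣∣≤1+L⇒Independent {I} ∣I∣≤1+L with ∣ I ∩ A ∣ ℕ.≤? L
  ... | yes ∣I∩A∣≤L = inj₂ (inj₂ (∣I∩A∣≤L , ℕP.≤-trans ∣I∣≤1+L 1+L≤M))
  ... | no ∣I∩A∣≰L  = inj₁ (∣p∣≤∣p∩q∣⇒p⊆q (ℕP.≤-trans ∣I∣≤1+L (ℕP.≰⇒> ∣I∩A∣≰L)))

  sumOver-w : ∀ I → sumOver I w ≡ ℕtoℚ (weight I)
  sumOver-w I = sumOver-twoValued D I A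

  weight≤D*∣∣ : ∀ I → weight I ℕ.≤ D ℕ.* ∣ I ∣
  weight≤D*∣∣ I = begin
    ∣ I ∩ A ∣ ℕ.+ D ℕ.* ∣ I ∩ ∁ A ∣       ≤⟨ ℕP.+-monoˡ-≤ _ (ℕP.m≤n*m ∣ I ∩ A ∣ D) ⟩
    D ℕ.* ∣ I ∩ A ∣ ℕ.+ D ℕ.* ∣ I ∩ ∁ A ∣ ≡⟨ ℕP.*-distribˡ-+ D ∣ I ∩ A ∣ _ ⟨
    D ℕ.* (∣ I ∩ A ∣ ℕ.+ ∣ I ∩ ∁ A ∣)     ≡⟨ cong (D ℕ.*_) (∣p∣≡∣p∩q∣+∣p∩∁q∣ I A) ⟨
    D ℕ.* ∣ I ∣                           ∎
    where open ℕP.≤-Reasoning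

  weight-off-A : ∀ {I} → (∀ {x} → x ∈ I → x ∉ A) → weight I ≡ D ℕ.* ∣ I ∣
  weight-off-A {I} I∩A=∅ = begin
    ∣ I ∩ A ∣ ℕ.+ D ℕ.* ∣ I ∩ ∁ A ∣ ≡⟨ cong (ℕ._+ D ℕ.* ∣ I ∩ ∁ A ∣) ∣I∩A∣≡0 ⟩
    D ℕ.* ∣ I ∩ ∁ A ∣               ≡⟨ cong (λ k → D ℕ.* (k ℕ.+ ∣ I ∩ ∁ A ∣)) ∣I∩A∣≡0 ⟨
    D ℕ.* (∣ I ∩ A ∣ ℕ.+ ∣ I ∩ ∁ A ∣) ≡⟨ cong (D ℕ.*_) (∣p∣≡∣p∩q∣+∣p∩∁q∣ I A) ⟨
    D ℕ.* ∣ I ∣                     ∎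
    where
    open ≡-Reasoning
    ∣I∩A∣≡0 : ∣ I ∩ A ∣ ≡ 0
    ∣I∩A∣≡0 = disjoint⇒∣p∩q∣≡0 I∩A=∅

  weight-on-A : ∀ {I} → I ⊆ A → weight I ≡ ∣ I ∣
  weight-on-A {I} I⊆A = begin
    ∣ I ∩ A ∣ ℕ.+ D ℕ.* ∣ I ∩ ∁ A ∣ ≡⟨ cong (λ k → ∣ I ∩ A ∣ ℕ.+ D ℕ.* k) ∣I∖A∣≡0 ⟩
    ∣ I ∩ A ∣ ℕ.+ D ℕ.* 0           ≡⟨ cong (∣ I ∩ A ∣ ℕ.+_) (ℕP.*-zeroʳ D) ⟩
    ∣ I ∩ A ∣ ℕ.+ 0                 ≡⟨ cong (∣ I ∩ A ∣ ℕ.+_) ∣I∖A∣≡0 ⟨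
    ∣ I ∩ A ∣ ℕ.+ ∣ I ∩ ∁ A ∣       ≡⟨ ∣p∣≡∣p∩q∣+∣p∩∁q∣ I A ⟨
    ∣ I ∣                           ∎
    where
    open ≡-Reasoning
    ∣I∖A∣≡0 : ∣ I ∩ ∁ A ∣ ≡ 0
    ∣I∖A∣≡0 = disjoint⇒∣p∩q∣≡0 (x∈p⇒x∉∁p ∘ I⊆A)

  f≤D* : ∀ {X c} → (∀ I → I ⊆ X → Independent I → ∣ I ∣ ℕ.≤ c) → f X ≤ ℕtoℚ (D ℕ.* c)
  f≤D* {X} {c} small = rankFn-lub system w X (0≤ℕtoℚ (D ℕ.* c)) λ I I⊆X indepI → begin
    sumOver I w       ≡⟨ sumOver-w I ⟩
    ℕtoℚ (weight I)   ≤⟨ ℕtoℚ-mono-≤ (ℕP.≤-trans (weight≤D*∣∣ I)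
                           (ℕP.*-monoʳ-≤ D (small I I⊆X (indep⇒Independent indepI)))) ⟩
    ℕtoℚ (D ℕ.* c)    ∎
    where open ℚP.≤-Reasoning

  D*∣∣≤f : ∀ {I X} → I ⊆ X → Independent I → (∀ {x} → x ∈ I → x ∉ A) → ℕtoℚ (D ℕ.* ∣ I ∣) ≤ f X
  D*∣∣≤f {I} {X} I⊆X indepI I∩A=∅ = begin
    ℕtoℚ (D ℕ.* ∣ I ∣) ≡⟨ cong ℕtoℚ (weight-off-A I∩A=∅) ⟨
    ℕtoℚ (weight I)    ≡⟨ sumOver-w I ⟨
    sumOver I w        ≤⟨ indep⇒sumOver≤rankFn system w X I⊆X (Independent⇒indep indepI) ⟩
    f X                ∎
    where open ℚP.≤-Reasoning

  D*i≤f : ∀ {i X} → i ℕ.≤ M → P i ⊆ X → ℕtoℚ (D ℕ.* i) ≤ f X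
  D*i≤f {i} {X} i≤M Pi⊆X = subst (λ k → ℕtoℚ (D ℕ.* k) ≤ f X) ∣Pi∣≡i
    (D*∣∣≤f Pi⊆X (inj₂ (inj₂ (∣Pi∩A∣≤L , subst (ℕ._≤ M) (sym ∣Pi∣≡i) i≤M))) Pi∩A=∅)
    where
    ∣Pi∣≡i : ∣ P i ∣ ≡ i
    ∣Pi∣≡i = ∣P∣ (ℕP.≤-trans i≤M M≤n)
    Pi∩A=∅ : ∀ {x} → x ∈ P i → x ∉ A
    Pi∩A=∅ = P-disjoint-A (ℕP.≤-trans i≤M (ℕP.m≤n+m M 2))
    ∣Pi∩A∣≤L : ∣ P i ∩ A ∣ ℕ.≤ L
    ∣Pi∩A∣≤L = ℕP.≤-trans (ℕP.≤-reflexive (disjoint⇒∣p∩q∣≡0 Pi∩A=∅)) z≤n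

  D*[1+M]≤f : ∀ {X} → B ⊆ X → ℕtoℚ (D ℕ.* suc M) ≤ f X
  D*[1+M]≤f {X} B⊆X = subst (λ k → ℕtoℚ (D ℕ.* k) ≤ f X) ∣B∣ (D*∣∣≤f B⊆X (inj₂ (inj₁ id)) B-disjoint-A)

  f≤D*[1+M] : ∀ X → f X ≤ ℕtoℚ (D ℕ.* suc M)
  f≤D*[1+M] X = f≤D* λ _ _ → Independent⇒∣∣≤1+M

  f[P]≤D*i : ∀ {i} → i ℕ.≤ n → f (P i) ≤ ℕtoℚ (D ℕ.* i)
  f[P]≤D*i {i} i≤n = f≤D* λ I I⊆Pi _ → subst (∣ I ∣ ℕ.≤_) (∣P∣ i≤n) (p⊆q⇒∣p∣≤∣q∣ I⊆Pi)

  f[P∪x]≤D*[1+i] : ∀ {i} → i ℕ.≤ n → ∀ x → f (P i ∪ ⁅ x ⁆) ≤ ℕtoℚ (D ℕ.* suc i)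
  f[P∪x]≤D*[1+i] {i} i≤n x = f≤D* λ I I⊆ _ → ℕP.≤-trans (p⊆q⇒∣p∣≤∣q∣ I⊆)
    (subst (λ k → ∣ P i ∪ ⁅ x ⁆ ∣ ℕ.≤ suc k) (∣P∣ i≤n) (∣p∪⁅x⁆∣≤1+∣p∣ (P i) x))

  f[PM∪x]≤D*M : ∀ x → f (P M ∪ ⁅ x ⁆) ≤ ℕtoℚ (D ℕ.* M)
  f[PM∪x]≤D*M x = f≤D* small
    where
    small : ∀ I → I ⊆ P M ∪ ⁅ x ⁆ → Independent I → ∣ I ∣ ℕ.≤ M
    small I I⊆ (inj₁ I⊆A) = ℕP.≤-trans (p⊆q⇒∣p∣≤∣q∣ I⊆⁅x⁆) (ℕP.≤-trans (ℕP.≤-reflexive (∣⁅x⁆∣≡1 x)) 1≤M)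
      where
      I⊆⁅x⁆ : I ⊆ ⁅ x ⁆
      I⊆⁅x⁆ y∈I with x∈p∪q⁻ (P M) ⁅ x ⁆ (I⊆ y∈I)
      ... | inj₁ y∈PM  = contradiction (I⊆A y∈I) (P-disjoint-A (ℕP.m≤n+m M 2) y∈PM)
      ... | inj₂ y∈⁅x⁆ = y∈⁅x⁆
    small I I⊆ (inj₂ (inj₁ I⊆B)) = ℕ.s≤s⁻¹ (begin-strict
      ∣ I ∣              <⟨ p⊂q⇒∣p∣<∣q∣ (I⊆ , fzero , zero∈ , zero∉B ∘ I⊆B) ⟩
      ∣ P M ∪ ⁅ x ⁆ ∣    ≤⟨ ∣p∪⁅x⁆∣≤1+∣p∣ (P M) x ⟩
      suc ∣ P M ∣        ≡⟨ cong suc (∣P∣ M≤n) ⟩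
      suc M              ∎)
      where
      open ℕP.≤-Reasoning
      zero∈ : fzero ∈ P M ∪ ⁅ x ⁆
      zero∈ = p⊆p∪q ⁅ x ⁆ (toℕ<⇒∈prefix-id 1≤M)
    small I I⊆ (inj₂ (inj₂ (_ , ∣I∣≤M))) = ∣I∣≤M

  greedy-choice : ∀ j x → Tri (toℕ j ℕ.< M) (toℕ j ≡ M) (M ℕ.< toℕ j) →
                  f (P (toℕ j) ∪ ⁅ x ⁆) ≤ f (P (toℕ j) ∪ ⁅ j ⁆)
  greedy-choice j x (tri< t<M _ _) = ℚP.≤-trans (f[P∪x]≤D*[1+i] (ℕP.<⇒≤ (FinP.toℕ<n j)) x)
    (D*i≤f {X = P (toℕ j) ∪ ⁅ j ⁆} t<M (⊆-reflexive (prefix-suc-toℕ id j)))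
  greedy-choice j x (tri≈ _ t≡M _) = subst (λ t → f (P t ∪ ⁅ x ⁆) ≤ f (P t ∪ ⁅ j ⁆)) (sym t≡M)
    (ℚP.≤-trans (f[PM∪x]≤D*M x) (D*i≤f {X = P M ∪ ⁅ j ⁆} ℕP.≤-refl (p⊆p∪q ⁅ j ⁆)))
  greedy-choice j x (tri> _ _ M<t) = ℚP.≤-trans (f≤D*[1+M] (P (toℕ j) ∪ ⁅ x ⁆))
    (D*[1+M]≤f {X = P (toℕ j) ∪ ⁅ j ⁆}
      (⊆-reflexive (prefix-suc-toℕ id j) ∘ prefix-mono id (s≤s M<t) ∘ proj₁ ∘ x∈p∩q⁻ (P (2 ℕ.+ M)) (∁ (P 1))))

  greedy : IsGreedyRun f id
  greedy j = ℕP.<-irrefl refl ∘ ∈prefix-id⇒toℕ< (toℕ j) , λ x _ → greedy-choice j x (ℕP.<-cmp (toℕ j) M)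

  saturated : Saturated f (P M)
  saturated x _ = ℚP.≤-antisym
    (ℚP.≤-trans (f[PM∪x]≤D*M x) (D*i≤f ℕP.≤-refl id))
    (ℚP.≤-trans (f[P]≤D*i M≤n) (D*i≤f ℕP.≤-refl (p⊆p∪q ⁅ x ⁆)))

  unsaturated : ∀ i → 1 ℕ.≤ i → i ℕ.< M → ¬ Saturated f (P i)
  unsaturated i _ i<M sat = ℚP.<-irrefl refl (begin-strict
    f (P i)              ≤⟨ f[P]≤D*i (ℕP.<⇒≤ i<n) ⟩
    ℕtoℚ (D ℕ.* i)       <⟨ ℕtoℚ-mono-< (ℕP.*-monoʳ-< D (ℕP.n<1+n i)) ⟩
    ℕtoℚ (D ℕ.* suc i)   ≤⟨ D*i≤f i<M (⊆-reflexive (prefix-suc id i<n)) ⟩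
    f (P i ∪ ⁅ u ⁆)      ≡⟨ sat u u∉Pi ⟩
    f (P i)              ∎)
    where
    open ℚP.≤-Reasoning
    i<n : i ℕ.< n
    i<n = ℕP.<-≤-trans i<M M≤n
    u : Fin n
    u = fromℕ< i<n
    u∉Pi : u ∉ P i
    u∉Pi = ℕP.<-irrefl (FinP.toℕ-fromℕ< i<n) ∘ ∈prefix-id⇒toℕ< i

  kbar : IsKbar f id M
  kbar = 1≤M , M≤n , saturated , unsaturated

  stalled : f (P M) < f ⊤
  stalled = begin-strict
    f (P M)              ≤⟨ f[P]≤D*i M≤n ⟩
    ℕtoℚ (D ℕ.* M)       <⟨ ℕtoℚ-mono-< (ℕP.*-monoʳ-< D (ℕP.n<1+n M)) ⟩
    ℕtoℚ (D ℕ.* suc M)   ≤⟨ D*[1+M]≤f ⊆⊤ ⟩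
    f ⊤                  ∎
    where open ℚP.≤-Reasoning

  weight≤M : ∀ {I y} → I ⊆ A ∪ ⁅ y ⁆ → Independent I → weight I ℕ.≤ M
  weight≤M {I} {y} I⊆ (inj₁ I⊆A) = begin
    weight I  ≡⟨ weight-on-A I⊆A ⟩
    ∣ I ∣     ≤⟨ p⊆q⇒∣p∣≤∣q∣ I⊆A ⟩
    ∣ A ∣     ≡⟨ ∣A∣ ⟩
    M         ∎
    where open ℕP.≤-Reasoning
  weight≤M {I} {y} I⊆ (inj₂ indepI) = ℕP.+-mono-≤ (∣I∩A∣≤L indepI) D*∣I∖A∣≤D
    where
    ∣I∩A∣≤L : I ⊆ B ⊎ (∣ I ∩ A ∣ ℕ.≤ L × ∣ I ∣ ℕ.≤ M) → ∣ I ∩ A ∣ ℕ.≤ L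
    ∣I∩A∣≤L (inj₁ I⊆B)          = ℕP.≤-trans (ℕP.≤-reflexive (disjoint⇒∣p∩q∣≡0 (B-disjoint-A ∘ I⊆B))) z≤n
    ∣I∩A∣≤L (inj₂ (∣I∩A∣≤L , _)) = ∣I∩A∣≤L
    I∖A⊆⁅y⁆ : I ∩ ∁ A ⊆ ⁅ y ⁆
    I∖A⊆⁅y⁆ x∈ with x∈p∩q⁻ I (∁ A) x∈
    ... | x∈I , x∈∁A with x∈p∪q⁻ A ⁅ y ⁆ (I⊆ x∈I)
    ...   | inj₁ x∈A  = contradiction x∈A (x∈∁p⇒x∉p x∈∁A)
    ...   | inj₂ x∈⁅y⁆ = x∈⁅y⁆
    D*∣I∖A∣≤D : D ℕ.* ∣ I ∩ ∁ A ∣ ℕ.≤ D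
    D*∣I∖A∣≤D = ℕP.≤-trans (ℕP.*-monoʳ-≤ D (ℕP.≤-trans (p⊆q⇒∣p∣≤∣q∣ I∖A⊆⁅y⁆) (ℕP.≤-reflexive (∣⁅x⁆∣≡1 y))))
                           (ℕP.≤-reflexive (ℕP.*-identityʳ D))

  f≤M : ∀ {X y} → X ⊆ A ∪ ⁅ y ⁆ → f X ≤ ℕtoℚ M
  f≤M {X} X⊆ = rankFn-lub system w X (0≤ℕtoℚ M) λ I I⊆X indepI →
    ℚP.≤-trans (ℚP.≤-reflexive (sumOver-w I)) (ℕtoℚ-mono-≤ (weight≤M (X⊆ ∘ I⊆X) (indep⇒Independent indepI)))

  M≤f[A] : ℕtoℚ M ≤ f A
  M≤f[A] = begin
    ℕtoℚ M           ≡⟨ cong ℕtoℚ (trans (sym ∣A∣) (sym (weight-on-A id))) ⟩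
    ℕtoℚ (weight A)  ≡⟨ sumOver-w A ⟨
    sumOver A w      ≤⟨ indep⇒sumOver≤rankFn system w A id (Independent⇒indep (inj₁ id)) ⟩
    f A              ∎
    where open ℚP.≤-Reasoning

  ¬augmentable : ∀ {α} → 0ℚ ≤ α → α ≤ ℕtoℚ D → ¬ Augmentable α f
  ¬augmentable {α} 0≤α α≤D = gainless⇒¬Augmentable {α = α} {f} B⊈A
    (λ {y} _ → ℚP.≤-trans (f≤M {y = y} id) M≤f[A]) (begin-strict
    α ℚ.* f A               ≤⟨ ℚP.*-monoˡ-≤-nonNeg α {{ℚ.nonNegative 0≤α}}
                                 (f≤M {y = fzero} (p⊆p∪q ⁅ fzero ⁆)) ⟩
    α ℚ.* ℕtoℚ M            ≤⟨ ℚP.*-monoʳ-≤-nonNeg (ℕtoℚ M) {{ℚ.nonNegative (0≤ℕtoℚ M)}} α≤D ⟩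
    ℕtoℚ D ℚ.* ℕtoℚ M       ≡⟨ ℕtoℚ-* D M ⟨
    ℕtoℚ (D ℕ.* M)          <⟨ ℕtoℚ-mono-< (ℕP.*-monoʳ-< D (ℕP.n<1+n M)) ⟩
    ℕtoℚ (D ℕ.* suc M)      ≤⟨ D*[1+M]≤f (q⊆p∪q A B) ⟩
    f (A ∪ B)               ∎)
    where open ℚP.≤-Reasoning

  rankQuotient : ∀ {q} → 0ℚ ≤ q → q ≤ 1ℚ → q ℚ.* ℕtoℚ (suc M) ≤ ℕtoℚ (suc L) → RankQuotientAtLeast q system
  rankQuotient 0≤q q≤1 = sizeBounds⇒RankQuotientAtLeast system 0≤q q≤1
    (λ _ → Independent⇒∣∣≤1+M ∘ indep⇒Independent) (λ _ → Independent⇒indep ∘ ∣∣≤1+L⇒Independent)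

  nonNegWeights : NonNegWeights w
  nonNegWeights x = 0≤ℕtoℚ (if lookup A x then 1 else D)

proposition16 : (γ q α : ℚ) → 0ℚ < γ → γ < 1ℚ → 0ℚ < q → q < 1ℚ → 1ℚ ≤ α →
    Σ ℕ λ n → Σ (IndepSystem n) λ S → Σ (Fin n → ℚ) λ w →
      NonNegWeights w × RankQuotientAtLeast q S ×
      Σ (Fin n → Fin n) λ g → IsGreedyRun (rankFn S w) g ×
        ¬ InFtilde γ (rankFn S w) g × ¬ InFα α (rankFn S w)
proposition16 γ q α 0<γ _ 0<q q<1 1≤α =
  n , system , w , nonNegWeights , rankQuotient (ℚP.<⇒≤ 0<q) (ℚP.<⇒≤ q<1) (proj₂ choice-of-L) ,
  id , greedy ,
  (λ (_ , wsr) → stalled⇒¬WeakSubmodRatioAtLeast {f = f} 0<γ kbar stalled wsr) ,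
  (λ (_ , aug) → ¬augmentable (ℚP.≤-trans (0≤ℕtoℚ 1) 1≤α) (p≤ℕtoℚ[1+∣↥p∣] α) aug)
  where
  choice-of-L : ∃ λ L → q ℚ.* ℕtoℚ (suc (L ℕ.+ suc ℤ.∣ ↥ α ∣)) ≤ ℕtoℚ (suc L)
  choice-of-L = ∃[L]q*[1+L+D]≤1+L q (suc ℤ.∣ ↥ α ∣) (ℚP.<⇒≤ 0<q) q<1
  open Counterexample (proj₁ choice-of-L) ℤ.∣ ↥ α ∣
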